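{- For $n\ge2$, the number of $132$-avoiding permutations $\sigma=\sigma_1\cdots\sigma_n$ of $\{1,\dots,n\}$ with $\sigma_1\neq n$ and exactly two indices $i$ satisfying $|\sigma_i-\sigma_{i+1}|=1$ or $|\sigma_{i-1}-\sigma_i|=1$ is $F_{n-1}$; the same holds with the condition $\sigma_1\ne n$ replaced by $\sigma_n\neq n$.
   Context: A permutation $\sigma$ avoids $132$ if there are no indices $i<j<k$ with $\sigma_i<\sigma_k<\sigma_j$. Conditions involving nonexistent entries $\sigma_0,\sigma_{n+1}$ are ignored. The Fibonacci numbers are defined by $F_0=F_1=1$ and $F_n=F_{n-1}+F_{n-2}$ for $n\ge2$. -}

module Defs where

open import Data.Nat using (ℕ; zero; suc; _+_; _∸_; _<ᵇ_; _≡ᵇ_)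
open import Data.Bool using (Bool; true; false; _∧_; _∨_; not)
open import Data.List using (List; []; _∷_; [_]; map; concatMap; filterᵇ; length; upTo)
open import Data.Bool.ListAction using (any)

fib : ℕ → ℕ
fib zero = 1
fib (suc zero) = 1
fib (suc (suc n)) = fib (suc n) + fib n

range1 : ℕ → List ℕ
range1 n = map suc (upTo n)

-- 1-indexed entry σᵢ of a word σ = σ₁⋯σₙ (0 if i is out of range; only used in range)
_!_ : List ℕ → ℕ → ℕ
[] ! _ = 0
(x ∷ xs) ! zero = 0
(x ∷ xs) ! suc zero = x
(x ∷ xs) ! suc (suc i) = xs ! suc i

words : ℕ → ℕ → List (List ℕ)
words zero m = [ [] ]
words (suc k) m = concatMap (λ x → map (x ∷_) (words k m)) (range1 m)

distinct : List ℕ → Bool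
distinct [] = true
distinct (x ∷ xs) = not (any (x ≡ᵇ_) xs) ∧ distinct xs

perms : ℕ → List (List ℕ)
perms n = filterᵇ distinct (words n n)

contains132 : ℕ → List ℕ → Bool
contains132 n σ =
  any (λ i → any (λ j → any (λ k →
        (i <ᵇ j) ∧ (j <ᵇ k) ∧ ((σ ! i) <ᵇ (σ ! k)) ∧ ((σ ! k) <ᵇ (σ ! j)))
      (range1 n)) (range1 n)) (range1 n)

avoids132 : ℕ → List ℕ → Bool
avoids132 n σ = not (contains132 n σ)

absDiff1 : ℕ → ℕ → Bool
absDiff1 a b = (suc a ≡ᵇ b) ∨ (suc b ≡ᵇ a)

-- index i (1 ≤ i ≤ n) satisfies |σᵢ - σᵢ₊₁| = 1 or |σᵢ₋₁ - σᵢ| = 1,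
-- conditions involving the nonexistent entries σ₀, σₙ₊₁ being ignored
adjIndex : ℕ → List ℕ → ℕ → Bool
adjIndex n σ i =
  ((i <ᵇ n) ∧ absDiff1 (σ ! i) (σ ! suc i)) ∨ ((1 <ᵇ i) ∧ absDiff1 (σ ! (i ∸ 1)) (σ ! i))

numAdj : ℕ → List ℕ → ℕ
numAdj n σ = length (filterᵇ (adjIndex n σ) (range1 n))

count : ℕ → (List ℕ → Bool) → ℕ
count n p = length (filterᵇ (λ σ → avoids132 n σ ∧ (numAdj n σ ≡ᵇ 2) ∧ p σ) (perms n))

firstNotN : ℕ → List ℕ → Bool
firstNotN n σ = not ((σ ! 1) ≡ᵇ n)

lastNotN : ℕ → List ℕ → Bool
lastNotN n σ = not ((σ ! n) ≡ᵇ n)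

-- Exactly two indices lie in a pair with |σᵢ − σᵢ₊₁| = 1 iff σ has exactly one such adjacent pair,
-- since the covered indices number the adjacent pairs plus the maximal runs of them.
-- A 132-avoiding permutation of {1,…,n} is α n β with α and β 132-avoiding permutations of
-- {|β|+1,…,n−1} and {1,…,|β|}; hence a 132-avoiding permutation of an interval of length ≥ 2
-- always has an adjacent pair (at the maximum, or by recursion into a side of length ≥ 2).
-- So for n ≥ 4 the counted permutations are exactly α n (α counted for n − 1, last entry ≠ n − 1),
-- n β (β counted for n − 1, first entry ≠ n − 1) and (γ + 1) n 1 (γ counted for n − 2, last entry
-- ≠ n − 2). With Aₙ, Bₙ the counts for σ₁ ≠ n and σₙ ≠ n this gives Aₙ = Bₙ₋₁ + Bₙ₋₂ and
-- Bₙ = Aₙ₋₁ + Bₙ₋₂, and Aₙ = Bₙ = Fₙ₋₁ follows from the values at n = 2, 3.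

module Submission where

open import Defs
open import Data.Nat using (ℕ; zero; suc; pred; _<?_; _+_; _∸_; _≤_; _<_; z≤n; s≤s; _<ᵇ_; _≡ᵇ_)
open import Data.Nat.Properties
open import Data.Bool using (Bool; true; false; _∧_; _∨_; not; T; T?)
open import Data.Bool.Properties using (∧-zeroʳ; ∧-identityʳ; ∨-identityʳ; ∨-comm; not-injective; ¬-not; not-¬)
open import Data.Bool.ListAction using (any)
open import Data.List using (List; []; _∷_; [_]; map; concatMap; cartesianProductWith; filterᵇ; length; _++_)
open import Data.List.Properties
  using (length-map; length-++; length-++-≤ʳ; map-∘; map-id-local; ++-cancelʳ; map-injective; ++-assoc;
         map-upTo; ∷-injective)
open import Data.List.Membership.Propositional using (_∈_; _∉_; find; lose)
open import Data.List.Membership.Propositional.Properties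
  using (∈-map⁺; ∈-map⁻; ∈-++⁺ˡ; ∈-++⁺ʳ; ∈-++⁻; ∈-∃++; ∈-filter⁺; ∈-filter⁻; ∈-upTo⁻; ∈-upTo⁺;
         ∈-cartesianProductWith⁺; ∈-cartesianProductWith⁻)
open import Data.List.Membership.DecPropositional _≟_ using (_∈?_)
open import Data.List.Relation.Unary.Any using (here; there)
open import Data.List.Relation.Unary.Any.Properties using (any⁺; any⁻)
open import Data.List.Relation.Unary.All as All using (All; []; _∷_)
import Data.List.Relation.Unary.All.Properties as All
open import Data.List.Relation.Unary.AllPairs using ([]; _∷_)
open import Data.List.Relation.Unary.Unique.Propositional using (Unique)
import Data.List.Relation.Unary.Unique.Propositional.Properties as Unique
open import Data.List.Relation.Binary.Disjoint.Propositional using (Disjoint)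
open import Data.List.Membership.Propositional.Properties.WithK using (unique∧set⇒bag)
open import Data.List.Relation.Binary.BagAndSetEquality using (∼bag⇒↭)
open import Data.List.Relation.Binary.Permutation.Propositional.Properties using (↭-length)
open import Function.Bundles using (mk⇔)
open import Data.Product using (_×_; _,_; proj₁; proj₂; ∃)
open import Data.Sum using (_⊎_; inj₁; inj₂)
open import Data.Empty using (⊥; ⊥-elim)
open import Data.Unit using (tt)
open import Function using (_∘_)
open import Induction.WellFounded using (Acc; acc)
open import Data.Nat.Induction using (<-wellFounded)
open import Relation.Nullary using (¬_; yes; no)
open import Relation.Binary.PropositionalEquality using (_≡_; refl; sym; trans; cong; cong₂; subst; subst₂; _≢_)
open import Relation.Binary.PropositionalEquality.Properties using (module ≡-Reasoning)

private variable A : Set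

T⇒≡true : ∀ {b} → T b → b ≡ true
T⇒≡true {true} _ = refl

≡true⇒T : ∀ {b} → b ≡ true → T b
≡true⇒T refl = tt

toℕ : Bool → ℕ
toℕ true = 1
toℕ false = 0

∧-true⁻ : ∀ {a b} → (a ∧ b) ≡ true → a ≡ true × b ≡ true
∧-true⁻ {true} {true} _ = refl , refl

∧-true⁺ : ∀ {a b} → a ≡ true → b ≡ true → (a ∧ b) ≡ true
∧-true⁺ refl refl = refl

∨-true⁻ : ∀ {a b} → (a ∨ b) ≡ true → a ≡ true ⊎ b ≡ true
∨-true⁻ {true} _ = inj₁ refl
∨-true⁻ {false} e = inj₂ e

∨-true⁺ʳ : ∀ a {b} → b ≡ true → (a ∨ b) ≡ true
∨-true⁺ʳ true _ = refl
∨-true⁺ʳ false e = e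

∨-false⁻ : ∀ {a b} → (a ∨ b) ≡ false → a ≡ false × b ≡ false
∨-false⁻ {false} e = refl , e

≡true-ext : ∀ {a b} → (a ≡ true → b ≡ true) → (b ≡ true → a ≡ true) → a ≡ b
≡true-ext {true} f _ = sym (f refl)
≡true-ext {false} {true} _ g = g refl
≡true-ext {false} {false} _ _ = refl

<ᵇ-true⇒< : ∀ {m n} → (m <ᵇ n) ≡ true → m < n
<ᵇ-true⇒< {m} {n} e = <ᵇ⇒< m n (≡true⇒T e)

<⇒<ᵇ-true : ∀ {m n} → m < n → (m <ᵇ n) ≡ true
<⇒<ᵇ-true p = T⇒≡true (<⇒<ᵇ p)

≥⇒<ᵇ-false : ∀ {m n} → n ≤ m → (m <ᵇ n) ≡ false
≥⇒<ᵇ-false n≤m = ¬-not (λ e → ≤⇒≯ n≤m (<ᵇ-true⇒< e))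

≡ᵇ-true⇒≡ : ∀ {m n} → (m ≡ᵇ n) ≡ true → m ≡ n
≡ᵇ-true⇒≡ {m} {n} e = ≡ᵇ⇒≡ m n (≡true⇒T e)

≡⇒≡ᵇ-true : ∀ {m n} → m ≡ n → (m ≡ᵇ n) ≡ true
≡⇒≡ᵇ-true {m} {n} p = T⇒≡true (≡⇒≡ᵇ m n p)

≢⇒≡ᵇ-false : ∀ {m n} → m ≢ n → (m ≡ᵇ n) ≡ false
≢⇒≡ᵇ-false m≢n = ¬-not (m≢n ∘ ≡ᵇ-true⇒≡)

Between : ℕ → ℕ → ℕ → Set
Between lo hi x = lo ≤ x × x < hi

range1-suc : ∀ m → range1 (suc m) ≡ 1 ∷ map suc (range1 m)
range1-suc m = cong (λ l → 1 ∷ map suc l) (sym (map-upTo suc m))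

∈-range1⁻ : ∀ {m x} → x ∈ range1 m → Between 1 (suc m) x
∈-range1⁻ x∈ with y , y∈ , refl ← ∈-map⁻ suc x∈ = s≤s z≤n , s≤s (∈-upTo⁻ y∈)

∈-range1⁺ : ∀ {m x} → Between 1 (suc m) x → x ∈ range1 m
∈-range1⁺ {x = suc y} (_ , s≤s y<m) = ∈-map⁺ suc (∈-upTo⁺ y<m)

range1-unique : ∀ m → Unique (range1 m)
range1-unique m = Unique.map⁺ suc-injective (Unique.upTo⁺ m)

any-range1⁻ : ∀ m (f : ℕ → Bool) → any f (range1 m) ≡ true → ∃ λ i → Between 1 (suc m) i × f i ≡ true
any-range1⁻ m f e with i , i∈ , fi ← find (any⁻ f (range1 m) (≡true⇒T e)) =
  i , ∈-range1⁻ i∈ , T⇒≡true fi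

any-range1⁺ : ∀ m {i} (f : ℕ → Bool) → Between 1 (suc m) i → f i ≡ true → any f (range1 m) ≡ true
any-range1⁺ m f i∈ fi = T⇒≡true (any⁺ f (lose (∈-range1⁺ i∈) (≡true⇒T fi)))

concatMap-prepend : ∀ (W : List (List ℕ)) xs →
  concatMap (λ x → map (x ∷_) W) xs ≡ cartesianProductWith _∷_ xs W
concatMap-prepend W [] = refl
concatMap-prepend W (x ∷ xs) = cong (map (x ∷_) W ++_) (concatMap-prepend W xs)

∈-words⁻ : ∀ k m {σ} → σ ∈ words k m → length σ ≡ k × All (Between 1 (suc m)) σ
∈-words⁻ zero m (here refl) = refl , []
∈-words⁻ (suc k) m σ∈
  with x , τ , x∈ , τ∈ , refl ← ∈-cartesianProductWith⁻ _∷_ (range1 m) (words k m)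
                                   (subst (_ ∈_) (concatMap-prepend (words k m) (range1 m)) σ∈)
  = cong suc (proj₁ (∈-words⁻ k m τ∈)) , ∈-range1⁻ x∈ ∷ proj₂ (∈-words⁻ k m τ∈)

∈-words⁺ : ∀ k m {σ} → length σ ≡ k → All (Between 1 (suc m)) σ → σ ∈ words k m
∈-words⁺ zero m {[]} _ _ = here refl
∈-words⁺ (suc k) m {x ∷ σ} e (x∈ ∷ σ∈) =
  subst (_ ∈_) (sym (concatMap-prepend (words k m) (range1 m)))
    (∈-cartesianProductWith⁺ _∷_ (∈-range1⁺ x∈) (∈-words⁺ k m (suc-injective e) σ∈))

words-unique : ∀ k m → Unique (words k m)
words-unique zero m = [] ∷ []
words-unique (suc k) m =
  subst Unique (sym (concatMap-prepend (words k m) (range1 m)))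
    (Unique.cartesianProductWith⁺ _∷_ ∷-injective (range1-unique m) (words-unique k m))

any-≡ᵇ-false⇒All≢ : ∀ x xs → any (x ≡ᵇ_) xs ≡ false → All (x ≢_) xs
any-≡ᵇ-false⇒All≢ x [] _ = []
any-≡ᵇ-false⇒All≢ x (y ∷ xs) e with ∨-false⁻ {x ≡ᵇ y} e
... | x≢ᵇy , rest = (λ x≡y → not-¬ (≡⇒≡ᵇ-true x≡y) x≢ᵇy) ∷ any-≡ᵇ-false⇒All≢ x xs rest

All≢⇒any-≡ᵇ-false : ∀ x xs → All (x ≢_) xs → any (x ≡ᵇ_) xs ≡ false
All≢⇒any-≡ᵇ-false x [] _ = refl
All≢⇒any-≡ᵇ-false x (y ∷ xs) (x≢y ∷ rest)
  rewrite ≢⇒≡ᵇ-false x≢y = All≢⇒any-≡ᵇ-false x xs rest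

distinct⇒Unique : ∀ σ → distinct σ ≡ true → Unique σ
distinct⇒Unique [] _ = []
distinct⇒Unique (x ∷ σ) e with ∧-true⁻ {not (any (x ≡ᵇ_) σ)} e
... | fresh , rest = any-≡ᵇ-false⇒All≢ x σ (not-injective fresh) ∷ distinct⇒Unique σ rest

Unique⇒distinct : ∀ σ → Unique σ → distinct σ ≡ true
Unique⇒distinct [] _ = refl
Unique⇒distinct (x ∷ σ) (fresh ∷ rest)
  rewrite All≢⇒any-≡ᵇ-false x σ fresh = Unique⇒distinct σ rest

IntervalPerm : ℕ → ℕ → List ℕ → Set
IntervalPerm lo len σ = length σ ≡ len × All (Between lo (lo + len)) σ × Unique σ

∈-perms⁻ : ∀ n {σ} → σ ∈ perms n → IntervalPerm 1 n σ
∈-perms⁻ n σ∈ with σ∈words , dist ← ∈-filter⁻ (T? ∘ distinct) σ∈ =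
  let len , bounded = ∈-words⁻ n n σ∈words in len , bounded , distinct⇒Unique _ (T⇒≡true dist)

∈-perms⁺ : ∀ n {σ} → IntervalPerm 1 n σ → σ ∈ perms n
∈-perms⁺ n (len , bounded , unique) =
  ∈-filter⁺ (T? ∘ distinct) (∈-words⁺ n n len bounded) (≡true⇒T (Unique⇒distinct _ unique))

perms-unique : ∀ n → Unique (perms n)
perms-unique n = Unique.filter⁺ (T? ∘ distinct) (words-unique n n)

-- Covered indices and adjacent pairs

length-filterᵇ-map : ∀ {B : Set} (f : A → Bool) (g : B → A) l →
  length (filterᵇ f (map g l)) ≡ length (filterᵇ (f ∘ g) l)
length-filterᵇ-map f g [] = refl
length-filterᵇ-map f g (x ∷ l) with f (g x)
... | true = cong suc (length-filterᵇ-map f g l)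
... | false = length-filterᵇ-map f g l

length-filterᵇ-∷ : ∀ (f : A → Bool) x l → length (filterᵇ f (x ∷ l)) ≡ toℕ (f x) + length (filterᵇ f l)
length-filterᵇ-∷ f x l with f x
... | true = refl
... | false = refl

countRange : ℕ → (ℕ → Bool) → ℕ
countRange m f = length (filterᵇ f (range1 m))

countRange-suc : ∀ m (f : ℕ → Bool) → countRange (suc m) f ≡ toℕ (f 1) + countRange m (f ∘ suc)
countRange-suc m f = begin
  length (filterᵇ f (range1 (suc m)))                ≡⟨ cong (length ∘ filterᵇ f) (range1-suc m) ⟩
  length (filterᵇ f (1 ∷ map suc (range1 m)))         ≡⟨ length-filterᵇ-∷ f 1 (map suc (range1 m)) ⟩
  toℕ (f 1) + length (filterᵇ f (map suc (range1 m))) ≡⟨ cong (toℕ (f 1) +_) (length-filterᵇ-map f suc (range1 m)) ⟩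
  toℕ (f 1) + countRange m (f ∘ suc)                  ∎
  where open ≡-Reasoning

countRange-cong : ∀ m {f g : ℕ → Bool} → (∀ i → f (suc i) ≡ g (suc i)) → countRange m f ≡ countRange m g
countRange-cong zero _ = refl
countRange-cong (suc m) {f} {g} f≗g = begin
  countRange (suc m) f                  ≡⟨ countRange-suc m f ⟩
  toℕ (f 1) + countRange m (f ∘ suc)    ≡⟨ cong₂ _+_ (cong toℕ (f≗g 0)) (countRange-cong m (f≗g ∘ suc)) ⟩
  toℕ (g 1) + countRange m (g ∘ suc)    ≡⟨ sym (countRange-suc m g) ⟩
  countRange (suc m) g                  ∎
  where open ≡-Reasoning

adjacenciesFrom : ℕ → List ℕ → ℕ
adjacenciesFrom x [] = 0
adjacenciesFrom x (y ∷ r) = toℕ (absDiff1 x y) + adjacenciesFrom y r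

adjacencies : List ℕ → ℕ
adjacencies [] = 0
adjacencies (x ∷ r) = adjacenciesFrom x r

-- The flag records whether the pair ending at the first entry is adjacent.
isCovered : Bool → List ℕ → ℕ → Bool
isCovered b σ i = (b ∧ (i ≡ᵇ 1)) ∨ adjIndex (length σ) σ i

coveredFrom : Bool → List ℕ → ℕ
coveredFrom b [] = 0
coveredFrom b (x ∷ []) = toℕ b
coveredFrom b (x ∷ y ∷ r) = toℕ (b ∨ absDiff1 x y) + coveredFrom (absDiff1 x y) (y ∷ r)

countRange-isCovered : ∀ b σ → countRange (length σ) (isCovered b σ) ≡ coveredFrom b σ
countRange-isCovered b [] = refl
countRange-isCovered b (x ∷ []) =
  trans (countRange-suc 0 (isCovered b (x ∷ [])))
        (trans (+-identityʳ _) (cong toℕ (trans (∨-identityʳ _) (∧-identityʳ b))))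
countRange-isCovered b (x ∷ y ∷ r) = begin
  countRange (suc (suc (length r))) (isCovered b (x ∷ y ∷ r))
    ≡⟨ countRange-suc (suc (length r)) (isCovered b (x ∷ y ∷ r)) ⟩
  toℕ (isCovered b (x ∷ y ∷ r) 1) + countRange (suc (length r)) (isCovered b (x ∷ y ∷ r) ∘ suc)
    ≡⟨ cong₂ _+_ (cong toℕ (cong₂ _∨_ (∧-identityʳ b) (∨-identityʳ _)))
                 (countRange-cong (suc (length r)) {isCovered b (x ∷ y ∷ r) ∘ suc} {isCovered a (y ∷ r)} shift) ⟩
  toℕ (b ∨ a) + countRange (suc (length r)) (isCovered a (y ∷ r))
    ≡⟨ cong (toℕ (b ∨ a) +_) (countRange-isCovered a (y ∷ r)) ⟩
  coveredFrom b (x ∷ y ∷ r) ∎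
  where
  open ≡-Reasoning
  a = absDiff1 x y
  shift : ∀ i → isCovered b (x ∷ y ∷ r) (suc (suc i)) ≡ isCovered a (y ∷ r) (suc i)
  shift zero rewrite ∧-zeroʳ b | ∧-identityʳ a = trans (∨-comm _ a) (cong (a ∨_) (sym (∨-identityʳ _)))
  shift (suc i) = cong (_∨ _) (trans (∧-zeroʳ b) (sym (∧-zeroʳ a)))

-- Number of maximal runs of consecutive adjacent pairs; the flag says whether a run is open.
runs : Bool → ℕ → List ℕ → ℕ
runs b x [] = toℕ b
runs b x (y ∷ r) = toℕ (b ∧ not (absDiff1 x y)) + runs (absDiff1 x y) y r

coveredFrom≡adjacencies+runs : ∀ b x r → coveredFrom b (x ∷ r) ≡ adjacenciesFrom x r + runs b x r
coveredFrom≡adjacencies+runs b x [] = refl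
coveredFrom≡adjacencies+runs b x (y ∷ r) rewrite coveredFrom≡adjacencies+runs (absDiff1 x y) y r
  with absDiff1 x y | b
... | true | true = refl
... | true | false = refl
... | false | true = sym (+-suc _ _)
... | false | false = refl

runs≤ : ∀ b x r → runs b x r ≤ toℕ b + adjacenciesFrom x r
runs≤ b x [] = ≤-reflexive (sym (+-identityʳ _))
runs≤ b x (y ∷ r) with runs≤ (absDiff1 x y) y r
... | ih with absDiff1 x y | b
... | true | true = m≤n⇒m≤1+n ih
... | true | false = ih
... | false | true = s≤s ih
... | false | false = ih

runs-positive : ∀ b x r → b ≡ true ⊎ 1 ≤ adjacenciesFrom x r → 1 ≤ runs b x r
runs-positive true x [] _ = s≤s z≤n
runs-positive false x [] (inj₂ ())
runs-positive b x (y ∷ r) open∨adj with absDiff1 x y | b | open∨adj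
... | true | _ | _ = ≤-trans (runs-positive true y r (inj₁ refl)) (m≤n+m _ _)
... | false | true | _ = s≤s z≤n
... | false | false | inj₂ adj = runs-positive false y r (inj₂ adj)

sum≡2⇒≡1 : ∀ a r → r ≤ a → (1 ≤ a → 1 ≤ r) → a + r ≡ 2 → a ≡ 1
sum≡2⇒≡1 zero zero _ _ ()
sum≡2⇒≡1 (suc zero) _ _ _ _ = refl
sum≡2⇒≡1 (suc (suc a)) r _ pos e with pos (s≤s z≤n)
... | s≤s _ = ⊥-elim (m+1+n≢0 a (suc-injective (suc-injective e)))

numAdj≡2⇒adjacencies≡1 : ∀ σ → numAdj (length σ) σ ≡ 2 → adjacencies σ ≡ 1
numAdj≡2⇒adjacencies≡1 [] ()
numAdj≡2⇒adjacencies≡1 (x ∷ r) e =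
  sum≡2⇒≡1 _ _ (runs≤ false x r) (runs-positive false x r ∘ inj₂)
    (trans (sym (coveredFrom≡adjacencies+runs false x r)) (trans (sym (countRange-isCovered false (x ∷ r))) e))

adjacencies≡1⇒numAdj≡2 : ∀ σ → adjacencies σ ≡ 1 → numAdj (length σ) σ ≡ 2
adjacencies≡1⇒numAdj≡2 [] ()
adjacencies≡1⇒numAdj≡2 (x ∷ r) e = begin
  numAdj (length (x ∷ r)) (x ∷ r)       ≡⟨ countRange-isCovered false (x ∷ r) ⟩
  coveredFrom false (x ∷ r)             ≡⟨ coveredFrom≡adjacencies+runs false x r ⟩
  adjacenciesFrom x r + runs false x r  ≡⟨ cong (_+ runs false x r) e ⟩
  1 + runs false x r                    ≡⟨ cong suc runs≡1 ⟩
  2                                     ∎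
  where
  open ≡-Reasoning
  runs≡1 : runs false x r ≡ 1
  runs≡1 = ≤-antisym (subst (runs false x r ≤_) e (runs≤ false x r))
                     (runs-positive false x r (inj₂ (≤-reflexive (sym e))))

-- 132-patterns

at : List ℕ → ℕ → ℕ
at σ i = σ ! suc i

at-++ˡ : ∀ (l r : List ℕ) k → k < length l → at (l ++ r) k ≡ at l k
at-++ˡ (x ∷ l) r zero _ = refl
at-++ˡ (x ∷ l) r (suc k) (s≤s k<l) = at-++ˡ l r k k<l

at-++ʳ : ∀ (l r : List ℕ) k → at (l ++ r) (length l + k) ≡ at r k
at-++ʳ [] r k = refl
at-++ʳ (x ∷ l) r k = at-++ʳ l r k

∈⇒at : ∀ {y} σ → y ∈ σ → ∃ λ k → k < length σ × at σ k ≡ y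
∈⇒at (x ∷ σ) (here refl) = 0 , s≤s z≤n , refl
∈⇒at (x ∷ σ) (there y∈) with k , k< , refl ← ∈⇒at σ y∈ = suc k , s≤s k< , refl

any⇒at : ∀ (f : ℕ → Bool) ys → any f ys ≡ true → ∃ λ k → k < length ys × f (at ys k) ≡ true
any⇒at f (y ∷ ys) e with ∨-true⁻ {f y} e
... | inj₁ fy = 0 , s≤s z≤n , fy
... | inj₂ rest with k , k< , fk ← any⇒at f ys rest = suc k , s≤s k< , fk

at⇒any : ∀ (f : ℕ → Bool) ys k → k < length ys → f (at ys k) ≡ true → any f ys ≡ true
at⇒any f (y ∷ ys) zero _ fy rewrite fy = refl
at⇒any f (y ∷ ys) (suc k) (s≤s k<) fk = ∨-true⁺ʳ (f y) (at⇒any f ys k k< fk)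

record Occurs132 (σ : List ℕ) : Set where
  constructor occurs132
  field
    {i j k} : ℕ
    i<j : i < j
    j<k : j < k
    k<n : k < length σ
    σi<σk : at σ i < at σ k
    σk<σj : at σ k < at σ j

-- The "32" of a 132-occurrence in σ whose "1" is the value x.
record Occurs32Above (x : ℕ) (σ : List ℕ) : Set where
  constructor occurs32
  field
    {j k} : ℕ
    j<k : j < k
    k<n : k < length σ
    x<σk : x < at σ k
    σk<σj : at σ k < at σ j

opens132 : ℕ → List ℕ → Bool
opens132 x [] = false
opens132 x (y ∷ ys) = ((x <ᵇ y) ∧ any (λ z → (x <ᵇ z) ∧ (z <ᵇ y)) ys) ∨ opens132 x ys

has132 : List ℕ → Bool
has132 [] = false
has132 (x ∷ xs) = opens132 x xs ∨ has132 xs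

opens132-sound : ∀ x ys → opens132 x ys ≡ true → Occurs32Above x ys
opens132-sound x (y ∷ ys) e with ∨-true⁻ {(x <ᵇ y) ∧ any (λ z → (x <ᵇ z) ∧ (z <ᵇ y)) ys} e
... | inj₁ here-y with _ , below ← ∧-true⁻ {x <ᵇ y} here-y
                  with k , k< , between ← any⇒at (λ z → (x <ᵇ z) ∧ (z <ᵇ y)) ys below
                  with x<z , z<y ← ∧-true⁻ {x <ᵇ at ys k} between
  = occurs32 (s≤s z≤n) (s≤s k<) (<ᵇ-true⇒< x<z) (<ᵇ-true⇒< z<y)
... | inj₂ later with occurs32 j<k k<n x<σk σk<σj ← opens132-sound x ys later
  = occurs32 (s≤s j<k) (s≤s k<n) x<σk σk<σj

opens132-complete : ∀ x ys → Occurs32Above x ys → opens132 x ys ≡ true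
opens132-complete x (y ∷ ys) (occurs32 {zero} {suc k} _ (s≤s k<n) x<σk σk<σj)
  rewrite <⇒<ᵇ-true (<-trans x<σk σk<σj)
        | at⇒any (λ z → (x <ᵇ z) ∧ (z <ᵇ y)) ys k k<n (∧-true⁺ (<⇒<ᵇ-true x<σk) (<⇒<ᵇ-true σk<σj))
  = refl
opens132-complete x (y ∷ ys) (occurs32 {suc j} {suc k} (s≤s j<k) (s≤s k<n) x<σk σk<σj) =
  ∨-true⁺ʳ _ (opens132-complete x ys (occurs32 j<k k<n x<σk σk<σj))

has132-sound : ∀ σ → has132 σ ≡ true → Occurs132 σ
has132-sound (x ∷ xs) e with ∨-true⁻ {opens132 x xs} e
... | inj₁ first with occurs32 j<k k<n x<σk σk<σj ← opens132-sound x xs first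
  = occurs132 (s≤s z≤n) (s≤s j<k) (s≤s k<n) x<σk σk<σj
... | inj₂ later with occurs132 i<j j<k k<n σi<σk σk<σj ← has132-sound xs later
  = occurs132 (s≤s i<j) (s≤s j<k) (s≤s k<n) σi<σk σk<σj

has132-complete : ∀ σ → Occurs132 σ → has132 σ ≡ true
has132-complete (x ∷ xs) (occurs132 {zero} {suc j} {suc k} _ (s≤s j<k) (s≤s k<n) σi<σk σk<σj)
  rewrite opens132-complete x xs (occurs32 j<k k<n σi<σk σk<σj) = refl
has132-complete (x ∷ xs) (occurs132 {suc i} {suc j} {suc k} (s≤s i<j) (s≤s j<k) (s≤s k<n) σi<σk σk<σj) =
  ∨-true⁺ʳ _ (has132-complete xs (occurs132 i<j j<k k<n σi<σk σk<σj))

contains132-sound : ∀ σ → contains132 (length σ) σ ≡ true → Occurs132 σ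
contains132-sound σ e
  with suc i , (_ , s≤s i<n) , e₁ ← any-range1⁻ (length σ) _ e
  with suc j , (_ , s≤s j<n) , e₂ ← any-range1⁻ (length σ) _ e₁
  with suc k , (_ , s≤s k<n) , e₃ ← any-range1⁻ (length σ) _ e₂
  with i<j , e₄ ← ∧-true⁻ {suc i <ᵇ suc j} e₃
  with j<k , e₅ ← ∧-true⁻ {suc j <ᵇ suc k} e₄
  with σi<σk , σk<σj ← ∧-true⁻ {at σ i <ᵇ at σ k} e₅
  = occurs132 (≤-pred (<ᵇ-true⇒< i<j)) (≤-pred (<ᵇ-true⇒< j<k)) k<n (<ᵇ-true⇒< σi<σk) (<ᵇ-true⇒< σk<σj)

contains132-complete : ∀ σ → Occurs132 σ → contains132 (length σ) σ ≡ true
contains132-complete σ (occurs132 {i} {j} {k} i<j j<k k<n σi<σk σk<σj) =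
  any-range1⁺ (length σ) _ (s≤s z≤n , s≤s (<-trans i<j (<-trans j<k k<n)))
    (any-range1⁺ (length σ) _ (s≤s z≤n , s≤s (<-trans j<k k<n))
      (any-range1⁺ (length σ) _ (s≤s z≤n , s≤s k<n)
        (∧-true⁺ (<⇒<ᵇ-true (s≤s i<j)) (∧-true⁺ (<⇒<ᵇ-true (s≤s j<k))
          (∧-true⁺ (<⇒<ᵇ-true σi<σk) (<⇒<ᵇ-true σk<σj))))))

contains132≡has132 : ∀ σ → contains132 (length σ) σ ≡ has132 σ
contains132≡has132 σ =
  ≡true-ext (has132-complete σ ∘ contains132-sound σ) (contains132-complete σ ∘ has132-sound σ)

Occurs32Above-++⁺ˡ : ∀ {x} l r → Occurs32Above x l → Occurs32Above x (l ++ r)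
Occurs32Above-++⁺ˡ {x} l r (occurs32 {j} {k} j<k k<n x<σk σk<σj) =
  occurs32 j<k (≤-trans k<n (≤-trans (m≤m+n (length l) (length r)) (≤-reflexive (sym (length-++ l)))))
    (subst (x <_) (sym (at-++ˡ l r k k<n)) x<σk)
    (subst₂ _<_ (sym (at-++ˡ l r k k<n)) (sym (at-++ˡ l r j (<-trans j<k k<n))) σk<σj)

Occurs32Above-++⁺ʳ : ∀ {x} l r → Occurs32Above x r → Occurs32Above x (l ++ r)
Occurs32Above-++⁺ʳ {x} l r (occurs32 {j} {k} j<k k<n x<σk σk<σj) =
  occurs32 (+-monoʳ-< (length l) j<k)
    (≤-trans (+-monoʳ-< (length l) k<n) (≤-reflexive (sym (length-++ l))))
    (subst (x <_) (sym (at-++ʳ l r k)) x<σk)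
    (subst₂ _<_ (sym (at-++ʳ l r k)) (sym (at-++ʳ l r j)) σk<σj)

opens132-++⁻ˡ : ∀ x l r → opens132 x (l ++ r) ≡ false → opens132 x l ≡ false
opens132-++⁻ˡ x l r e =
  ¬-not λ t → not-¬ (opens132-complete x _ (Occurs32Above-++⁺ˡ l r (opens132-sound x l t))) e

opens132-++⁻ʳ : ∀ x l r → opens132 x (l ++ r) ≡ false → opens132 x r ≡ false
opens132-++⁻ʳ x l r e =
  ¬-not λ t → not-¬ (opens132-complete x _ (Occurs32Above-++⁺ʳ l r (opens132-sound x r t))) e

has132-++⁻ˡ : ∀ l r → has132 (l ++ r) ≡ false → has132 l ≡ false
has132-++⁻ˡ [] r e = refl
has132-++⁻ˡ (x ∷ l) r e with ∨-false⁻ {opens132 x (l ++ r)} e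
... | e₁ , e₂ rewrite opens132-++⁻ˡ x l r e₁ = has132-++⁻ˡ l r e₂

has132-++⁻ʳ : ∀ l r → has132 (l ++ r) ≡ false → has132 r ≡ false
has132-++⁻ʳ [] r e = e
has132-++⁻ʳ (x ∷ l) r e = has132-++⁻ʳ l r (proj₂ (∨-false⁻ {opens132 x (l ++ r)} e))

has132-++⇒opens132 : ∀ l r {x} → has132 (l ++ r) ≡ false → x ∈ l → opens132 x r ≡ false
has132-++⇒opens132 (x ∷ l) r e (here refl) = opens132-++⁻ʳ x l r (proj₁ (∨-false⁻ {opens132 x (l ++ r)} e))
has132-++⇒opens132 (x ∷ l) r e (there x∈) = has132-++⇒opens132 l r (proj₂ (∨-false⁻ {opens132 x (l ++ r)} e)) x∈

opens132-false-∷ : ∀ x m β {y} → opens132 x (m ∷ β) ≡ false → y ∈ β → x < y → y < m → ⊥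
opens132-false-∷ x m β e y∈ x<y y<m with k , k< , refl ← ∈⇒at β y∈ =
  not-¬ (opens132-complete x (m ∷ β) (occurs32 (s≤s z≤n) (s≤s k<) x<y y<m)) e

any-++-[] : ∀ (f : A → Bool) l z → f z ≡ false → any f (l ++ [ z ]) ≡ any f l
any-++-[] f [] z fz rewrite fz = refl
any-++-[] f (x ∷ l) z fz = cong (f x ∨_) (any-++-[] f l z fz)

opens132-++-[] : ∀ a l z → (∀ {y} → y ∈ l → ((a <ᵇ z) ∧ (z <ᵇ y)) ≡ false) →
  opens132 a (l ++ [ z ]) ≡ opens132 a l
opens132-++-[] a [] z _ rewrite ∧-zeroʳ (a <ᵇ z) = refl
opens132-++-[] a (y ∷ l) z not-between
  rewrite any-++-[] (λ w → (a <ᵇ w) ∧ (w <ᵇ y)) l z (not-between (here refl))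
        | opens132-++-[] a l z (not-between ∘ there) = refl

has132-++-[] : ∀ l z → (∀ {a y} → a ∈ l → y ∈ l → ((a <ᵇ z) ∧ (z <ᵇ y)) ≡ false) →
  has132 (l ++ [ z ]) ≡ has132 l
has132-++-[] [] z _ = refl
has132-++-[] (x ∷ l) z not-between
  rewrite opens132-++-[] x l z (not-between (here refl) ∘ there)
        | has132-++-[] l z (λ a∈ y∈ → not-between (there a∈) (there y∈)) = refl

has132-++-[max] : ∀ l m → All (_< m) l → has132 (l ++ [ m ]) ≡ has132 l
has132-++-[max] l m below = has132-++-[] l m λ {a} _ y∈ →
  trans (cong ((a <ᵇ m) ∧_) (≥⇒<ᵇ-false (<⇒≤ (All.lookup below y∈)))) (∧-zeroʳ _)

has132-++-[min] : ∀ l m → All (m <_) l → has132 (l ++ [ m ]) ≡ has132 l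
has132-++-[min] l m above = has132-++-[] l m λ {_} {y} a∈ _ →
  cong (_∧ (m <ᵇ y)) (≥⇒<ᵇ-false (<⇒≤ (All.lookup above a∈)))

opens132-max : ∀ m l → All (_< m) l → opens132 m l ≡ false
opens132-max m [] _ = refl
opens132-max m (y ∷ l) (y<m ∷ below) rewrite ≥⇒<ᵇ-false (<⇒≤ y<m) | opens132-max m l below = refl

any-map : ∀ (f : ℕ → Bool) (g : ℕ → ℕ) l → any f (map g l) ≡ any (f ∘ g) l
any-map f g [] = refl
any-map f g (x ∷ l) = cong (f (g x) ∨_) (any-map f g l)

opens132-map-suc : ∀ a l → opens132 (suc a) (map suc l) ≡ opens132 a l
opens132-map-suc a [] = refl
opens132-map-suc a (y ∷ l)
  rewrite any-map (λ z → (suc a <ᵇ z) ∧ (z <ᵇ suc y)) suc l | opens132-map-suc a l = refl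

has132-map-suc : ∀ l → has132 (map suc l) ≡ has132 l
has132-map-suc [] = refl
has132-map-suc (x ∷ l) rewrite opens132-map-suc x l | has132-map-suc l = refl

-- Permutations of intervals and their decomposition at the maximum

Unique-++⁻ˡ : ∀ (l r : List A) → Unique (l ++ r) → Unique l
Unique-++⁻ˡ [] r _ = []
Unique-++⁻ˡ (x ∷ l) r (x∉ ∷ u) = All.++⁻ˡ l x∉ ∷ Unique-++⁻ˡ l r u

Unique-++⁻ʳ : ∀ (l r : List A) → Unique (l ++ r) → Unique r
Unique-++⁻ʳ [] r u = u
Unique-++⁻ʳ (x ∷ l) r (_ ∷ u) = Unique-++⁻ʳ l r u

Unique-++⇒Disjoint : ∀ (l r : List A) → Unique (l ++ r) → ∀ {a} → a ∈ l → a ∉ r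
Unique-++⇒Disjoint (x ∷ l) r (x∉ ∷ u) (here refl) a∈r = All.lookup x∉ (∈-++⁺ʳ l a∈r) refl
Unique-++⇒Disjoint (x ∷ l) r (_ ∷ u) (there a∈l) a∈r = Unique-++⇒Disjoint l r u a∈l a∈r

Unique-remove : ∀ (l₁ l₂ : List A) y → Unique (l₁ ++ y ∷ l₂) → Unique (l₁ ++ l₂)
Unique-remove [] l₂ y (_ ∷ u) = u
Unique-remove (x ∷ l₁) l₂ y (x∉ ∷ u) =
  All.++⁺ (All.++⁻ˡ l₁ x∉) (All.tail (All.++⁻ʳ l₁ x∉)) ∷ Unique-remove l₁ l₂ y u

∈-insert : ∀ (l₁ l₂ : List A) y {x} → x ∈ l₁ ++ l₂ → x ∈ l₁ ++ y ∷ l₂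
∈-insert l₁ l₂ y x∈ with ∈-++⁻ l₁ x∈
... | inj₁ x∈l₁ = ∈-++⁺ˡ x∈l₁
... | inj₂ x∈l₂ = ∈-++⁺ʳ l₁ (there x∈l₂)

Unique-removed-∉ : ∀ (l₁ l₂ : List A) y → Unique (l₁ ++ y ∷ l₂) → ∀ {x} → x ∈ l₁ ++ l₂ → x ≢ y
Unique-removed-∉ l₁ l₂ y u x∈ refl with ∈-++⁻ l₁ x∈
... | inj₁ x∈l₁ = Unique-++⇒Disjoint l₁ (y ∷ l₂) u x∈l₁ (here refl)
... | inj₂ x∈l₂ with y∉ ∷ _ ← Unique-++⁻ʳ l₁ (y ∷ l₂) u = All.lookup y∉ x∈l₂ refl

<-suc-≢⇒< : ∀ {x h} → x < suc h → x ≢ h → x < h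
<-suc-≢⇒< x<1+h x≢h = ≤∧≢⇒< (≤-pred x<1+h) x≢h

pigeonhole : ∀ hi {lo} l → Unique l → All (Between lo hi) l → lo ≤ hi → lo + length l ≤ hi
pigeonhole zero [] _ _ lo≤0 = ≤-trans (≤-reflexive (+-identityʳ _)) lo≤0
pigeonhole zero (x ∷ l) _ ((_ , ()) ∷ _) _
pigeonhole (suc h) {lo} l u bounded lo≤hi with h ∈? l
... | no h∉l with l
...   | [] = ≤-trans (≤-reflexive (+-identityʳ lo)) lo≤hi
...   | x ∷ l′ = m≤n⇒m≤1+n (pigeonhole h (x ∷ l′) u below (≤-trans lo≤x (<⇒≤ x<h)))
  where
  below : All (Between lo h) (x ∷ l′)
  below = All.tabulate λ {y} y∈ → let lo≤y , y<1+h = All.lookup bounded y∈ in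
    lo≤y , <-suc-≢⇒< y<1+h (λ { refl → h∉l y∈ })
  lo≤x = proj₁ (All.lookup below (here refl))
  x<h = proj₂ (All.lookup below (here refl))
pigeonhole (suc h) {lo} l u bounded lo≤hi | yes h∈l with l₁ , l₂ , refl ← ∈-∃++ h∈l = begin
  lo + length (l₁ ++ h ∷ l₂)    ≡⟨ cong (lo +_) (length-++ l₁) ⟩
  lo + (length l₁ + suc (length l₂)) ≡⟨ cong (lo +_) (+-suc (length l₁) _) ⟩
  lo + suc (length l₁ + length l₂)  ≡⟨ +-suc lo _ ⟩
  suc (lo + (length l₁ + length l₂)) ≡⟨ cong (λ n → suc (lo + n)) (sym (length-++ l₁)) ⟩
  suc (lo + length (l₁ ++ l₂))  ≤⟨ s≤s (pigeonhole h (l₁ ++ l₂) (Unique-remove l₁ l₂ h u) below lo≤h) ⟩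
  suc h                          ∎
  where
  open ≤-Reasoning
  below : All (Between lo h) (l₁ ++ l₂)
  below = All.tabulate λ y∈ → let lo≤y , y<1+h = All.lookup bounded (∈-insert l₁ l₂ h y∈) in
    lo≤y , <-suc-≢⇒< y<1+h (Unique-removed-∉ l₁ l₂ h u y∈)
  lo≤h = proj₁ (All.lookup bounded (∈-++⁺ʳ l₁ (here refl)))

max∈ : ∀ lo k σ → IntervalPerm lo (suc k) σ → lo + k ∈ σ
max∈ lo k σ (len , bounded , u) with lo + k ∈? σ
... | yes top∈ = top∈
... | no top∉ = ⊥-elim (1+n≰n (begin
  suc (lo + k)      ≡⟨ sym (+-suc lo k) ⟩
  lo + suc k        ≡⟨ cong (lo +_) (sym len) ⟩
  lo + length σ     ≤⟨ pigeonhole (lo + k) σ u below (m≤m+n lo k) ⟩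
  lo + k            ∎))
  where
  open ≤-Reasoning
  below : All (Between lo (lo + k)) σ
  below = All.tabulate λ {y} y∈ → let lo≤y , y<top = All.lookup bounded y∈ in
    lo≤y , <-suc-≢⇒< (subst (y <_) (+-suc lo k) y<top) (λ { refl → top∉ y∈ })

-- Two blocks of distinct values filling [lo, lo + |β| + |α|), with all of β below all of α,
-- must be the lower and upper subintervals: otherwise one block overflows by pigeonhole.
separated-blocks : ∀ lo (α β : List ℕ) → Unique α → Unique β →
  All (Between lo (lo + length β + length α)) α → All (Between lo (lo + length β + length α)) β →
  (∀ {x y} → x ∈ α → y ∈ β → y < x) →
  All (Between (lo + length β) (lo + length β + length α)) α × All (Between lo (lo + length β)) β
separated-blocks lo α β uα uβ inα inβ β<α =
  All.tabulate (λ x∈ → lower x∈ , proj₂ (All.lookup inα x∈)) ,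
  All.tabulate (λ y∈ → proj₁ (All.lookup inβ y∈) , upper y∈)
  where
  hi = lo + length β + length α
  lower : ∀ {x} → x ∈ α → lo + length β ≤ x
  lower {x} x∈ with x <? lo + length β
  ... | no x≮ = ≮⇒≥ x≮
  ... | yes x< = ⊥-elim (<⇒≱ x<
        (pigeonhole x β uβ (All.tabulate λ y∈ → proj₁ (All.lookup inβ y∈) , β<α x∈ y∈)
                    (proj₁ (All.lookup inα x∈))))
  upper : ∀ {y} → y ∈ β → y < lo + length β
  upper {y} y∈ with y <? lo + length β
  ... | yes y< = y<
  ... | no y≮ = ⊥-elim (1+n≰n (begin
        suc (y + length α)
          ≤⟨ pigeonhole hi α uα (All.tabulate λ x∈ → β<α x∈ y∈ , proj₂ (All.lookup inα x∈))
                                (proj₂ (All.lookup inβ y∈)) ⟩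
        hi
          ≤⟨ +-monoˡ-≤ (length α) (≮⇒≥ y≮) ⟩
        y + length α ∎))
    where open ≤-Reasoning

decompose-at-max : ∀ lo k α β → IntervalPerm lo (suc k) (α ++ (lo + k) ∷ β) →
  has132 (α ++ (lo + k) ∷ β) ≡ false →
  IntervalPerm (lo + length β) (length α) α × IntervalPerm lo (length β) β
decompose-at-max lo k α β (len , bounded , u) avoids =
  let inα , inβ = separated-blocks lo α β uα uβ (All.tabulate boundα) (All.tabulate boundβ) β<α
  in (refl , inα , uα) , (refl , inβ , uβ)
  where
  top = lo + k
  k≡ : k ≡ length β + length α
  k≡ = suc-injective (begin
    suc k                           ≡⟨ sym len ⟩
    length (α ++ top ∷ β)           ≡⟨ length-++ α ⟩
    length α + suc (length β)       ≡⟨ +-suc (length α) _ ⟩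
    suc (length α + length β)       ≡⟨ cong suc (+-comm (length α) _) ⟩
    suc (length β + length α)       ∎)
    where open ≡-Reasoning
  uα : Unique α
  uα = Unique-++⁻ˡ α (top ∷ β) u
  uβ : Unique β
  uβ with _ ∷ uβ ← Unique-++⁻ʳ α (top ∷ β) u = uβ
  top∉β : All (top ≢_) β
  top∉β with top∉β ∷ _ ← Unique-++⁻ʳ α (top ∷ β) u = top∉β
  below-top : ∀ {v} → v ∈ α ++ top ∷ β → v ≢ top → v < top
  below-top {v} v∈ v≢top = <-suc-≢⇒< (subst (v <_) (+-suc lo k) (proj₂ (All.lookup bounded v∈))) v≢top
  top≡ : top ≡ lo + length β + length α
  top≡ = trans (cong (lo +_) k≡) (sym (+-assoc lo _ _))
  α<top : ∀ {x} → x ∈ α → x < top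
  α<top x∈ = below-top (∈-++⁺ˡ x∈) (λ { refl → Unique-++⇒Disjoint α (top ∷ β) u x∈ (here refl) })
  β<top : ∀ {y} → y ∈ β → y < top
  β<top y∈ = below-top (∈-++⁺ʳ α (there y∈)) (λ { refl → All.lookup top∉β y∈ refl })
  boundα : ∀ {x} → x ∈ α → Between lo (lo + length β + length α) x
  boundα {x} x∈ = proj₁ (All.lookup bounded (∈-++⁺ˡ x∈)) , subst (x <_) top≡ (α<top x∈)
  boundβ : ∀ {y} → y ∈ β → Between lo (lo + length β + length α) y
  boundβ {y} y∈ = proj₁ (All.lookup bounded (∈-++⁺ʳ α (there y∈))) , subst (y <_) top≡ (β<top y∈)
  β<α : ∀ {x y} → x ∈ α → y ∈ β → y < x
  β<α {x} {y} x∈ y∈ = ≤∧≢⇒<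
    (≮⇒≥ λ x<y → opens132-false-∷ x top β (has132-++⇒opens132 α (top ∷ β) avoids x∈) y∈ x<y (β<top y∈))
    (λ { refl → Unique-++⇒Disjoint α (top ∷ β) u x∈ (there y∈) })

-- Adjacent pairs in 132-avoiding permutations

lastOr : ℕ → List ℕ → ℕ
lastOr d [] = d
lastOr d (x ∷ l) = lastOr x l

lastOr-++-∷ : ∀ d (l : List ℕ) z r → lastOr d (l ++ z ∷ r) ≡ lastOr z r
lastOr-++-∷ d [] z r = refl
lastOr-++-∷ d (x ∷ l) z r = lastOr-++-∷ x l z r

lastOr-∈ : ∀ x l → lastOr x l ∈ x ∷ l
lastOr-∈ x [] = here refl
lastOr-∈ x (y ∷ l) = there (lastOr-∈ y l)

lastOr-map-suc : ∀ d l → lastOr (suc d) (map suc l) ≡ suc (lastOr d l)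
lastOr-map-suc d [] = refl
lastOr-map-suc d (x ∷ l) = lastOr-map-suc x l

!-length≡lastOr : ∀ σ → σ ! length σ ≡ lastOr 0 σ
!-length≡lastOr [] = refl
!-length≡lastOr (x ∷ []) = refl
!-length≡lastOr (x ∷ y ∷ r) = !-length≡lastOr (y ∷ r)

absDiff1-n-1+n : ∀ n → absDiff1 n (suc n) ≡ true
absDiff1-n-1+n n rewrite ≡⇒≡ᵇ-true (refl {x = n}) = refl

absDiff1-1+n-n : ∀ n → absDiff1 (suc n) n ≡ true
absDiff1-1+n-n n = trans (∨-comm (suc (suc n) ≡ᵇ n) _) (absDiff1-n-1+n n)

absDiff1-false : ∀ {a b} → suc a ≢ b → suc b ≢ a → absDiff1 a b ≡ false
absDiff1-false 1+a≢b 1+b≢a rewrite ≢⇒≡ᵇ-false 1+a≢b | ≢⇒≡ᵇ-false 1+b≢a = refl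

adjacenciesFrom-++ : ∀ p l r → adjacenciesFrom p (l ++ r) ≡ adjacenciesFrom p l + adjacenciesFrom (lastOr p l) r
adjacenciesFrom-++ p [] r = refl
adjacenciesFrom-++ p (x ∷ l) r rewrite adjacenciesFrom-++ x l r = sym (+-assoc (toℕ (absDiff1 p x)) _ _)

adjacenciesFrom-map-suc : ∀ p l → adjacenciesFrom (suc p) (map suc l) ≡ adjacenciesFrom p l
adjacenciesFrom-map-suc p [] = refl
adjacenciesFrom-map-suc p (x ∷ l) = cong (toℕ (absDiff1 p x) +_) (adjacenciesFrom-map-suc x l)

adjacencies-map-suc : ∀ l → adjacencies (map suc l) ≡ adjacencies l
adjacencies-map-suc [] = refl
adjacencies-map-suc (x ∷ l) = adjacenciesFrom-map-suc x l

adjacencies≤adjacenciesFrom : ∀ p r → adjacencies r ≤ adjacenciesFrom p r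
adjacencies≤adjacenciesFrom p [] = z≤n
adjacencies≤adjacenciesFrom p (y ∷ r) = m≤n+m (adjacenciesFrom y r) _

singleton-interval : ∀ {lo x} → IntervalPerm lo 1 (x ∷ []) → x ≡ lo
singleton-interval {lo} {x} ((_ , (lo≤x , x<) ∷ [] , _)) =
  ≤-antisym (≤-pred (subst (x <_) (trans (+-suc lo 0) (cong suc (+-identityʳ lo))) x<)) lo≤x

length<length-++-∷ˡ : ∀ (α β : List A) x → length α < length (α ++ x ∷ β)
length<length-++-∷ˡ α β x = begin-strict
  length α                  <⟨ m<m+n (length α) (s≤s z≤n) ⟩
  length α + length (x ∷ β) ≡⟨ sym (length-++ α) ⟩
  length (α ++ x ∷ β)       ∎
  where open ≤-Reasoning

length<length-++-∷ʳ : ∀ (α β : List A) x → length β < length (α ++ x ∷ β)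
length<length-++-∷ʳ α β x = length-++-≤ʳ (x ∷ β) {α}

mutual
  has-adjacency-acc : ∀ {lo k} σ → Acc _<_ (length σ) →
    IntervalPerm lo (2 + k) σ → has132 σ ≡ false → 1 ≤ adjacencies σ
  has-adjacency-acc {lo} {k} σ rec perm avoids with α , β , refl ← ∈-∃++ (max∈ lo (suc k) σ perm) =
    has-adjacency-around-max α β rec perm avoids

  -- Either the maximum is adjacent to its only neighbour, or one side has length ≥ 2.
  has-adjacency-around-max : ∀ {lo k} α β → let σ = α ++ (lo + suc k) ∷ β in Acc _<_ (length σ) →
    IntervalPerm lo (2 + k) σ → has132 σ ≡ false → 1 ≤ adjacencies σ
  has-adjacency-around-max [] [] _ (() , _) _
  has-adjacency-around-max {lo} {k} [] (y ∷ []) _ perm avoids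
    with refl ← suc-injective (suc-injective (proj₁ perm))
    with refl ← singleton-interval (proj₂ (decompose-at-max lo 1 [] (y ∷ []) perm avoids))
    rewrite +-suc y 0 | +-identityʳ y | absDiff1-1+n-n y = s≤s z≤n
  has-adjacency-around-max {lo} {k} [] β@(_ ∷ _ ∷ _) (acc rec) perm avoids =
    ≤-trans (has-adjacency-acc β (rec (length<length-++-∷ʳ [] β (lo + suc k)))
              (proj₂ (decompose-at-max lo (suc k) [] β perm avoids)) (has132-++⁻ʳ [ lo + suc k ] β avoids))
            (adjacencies≤adjacenciesFrom (lo + suc k) β)
  has-adjacency-around-max {lo} {k} (x ∷ []) β _ perm avoids
    with refl ← suc-injective (suc-injective (proj₁ perm))
    with refl ← singleton-interval (proj₁ (decompose-at-max lo (suc k) (x ∷ []) β perm avoids))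
    rewrite +-suc lo (length β) | absDiff1-n-1+n (lo + length β) = s≤s z≤n
  has-adjacency-around-max {lo} {k} α@(x ∷ x′ ∷ α′) β (acc rec) perm avoids = begin
    1
      ≤⟨ has-adjacency-acc α (rec (length<length-++-∷ˡ α β (lo + suc k))) permα (has132-++⁻ˡ α _ avoids) ⟩
    adjacencies α
      ≤⟨ m≤m+n _ _ ⟩
    adjacencies α + adjacenciesFrom (lastOr x (x′ ∷ α′)) ((lo + suc k) ∷ β)
      ≡⟨ sym (adjacenciesFrom-++ x (x′ ∷ α′) _) ⟩
    adjacencies (α ++ (lo + suc k) ∷ β) ∎
    where
    open ≤-Reasoning
    permα = proj₁ (decompose-at-max lo (suc k) α β perm avoids)

has-adjacency : ∀ {lo k} σ → IntervalPerm lo (2 + k) σ → has132 σ ≡ false → 1 ≤ adjacencies σ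
has-adjacency σ = has-adjacency-acc σ (<-wellFounded (length σ))

Admissible : ℕ → List ℕ → Set
Admissible n σ = IntervalPerm 1 n σ × has132 σ ≡ false × adjacencies σ ≡ 1

FirstNotMax : ℕ → List ℕ → Set
FirstNotMax n σ = Admissible n σ × σ ! 1 ≢ n

LastNotMax : ℕ → List ℕ → Set
LastNotMax n σ = Admissible n σ × lastOr 0 σ ≢ n

counted : ℕ → (List ℕ → Bool) → List (List ℕ)
counted n p = filterᵇ (λ σ → avoids132 n σ ∧ (numAdj n σ ≡ᵇ 2) ∧ p σ) (perms n)

counted-unique : ∀ n p → Unique (counted n p)
counted-unique n p = Unique.filter⁺ _ (perms-unique n)

countedFirst countedLast : ℕ → List (List ℕ)
countedFirst n = counted n (firstNotN n)
countedLast n = counted n (lastNotN n)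

∈-counted⁻ : ∀ n p {σ} → σ ∈ counted n p → Admissible n σ × p σ ≡ true
∈-counted⁻ n p {σ} σ∈ with σ∈perms , holds ← ∈-filter⁻ (T? ∘ _) σ∈
  with perm@(refl , _) ← ∈-perms⁻ n σ∈perms
  with avoids , rest ← ∧-true⁻ {avoids132 (length σ) σ} (T⇒≡true holds)
  with two , pσ ← ∧-true⁻ {numAdj (length σ) σ ≡ᵇ 2} rest
  = (perm , not-injective (trans (sym (cong not (contains132≡has132 σ))) avoids)
          , numAdj≡2⇒adjacencies≡1 σ (≡ᵇ-true⇒≡ two)) , pσ

∈-counted⁺ : ∀ n p {σ} → Admissible n σ → p σ ≡ true → σ ∈ counted n p
∈-counted⁺ n p {σ} (perm@(refl , _) , avoids , one) pσ =
  ∈-filter⁺ (T? ∘ _) (∈-perms⁺ n perm) (≡true⇒T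
    (∧-true⁺ (trans (cong not (contains132≡has132 σ)) (cong not avoids))
      (∧-true⁺ (≡⇒≡ᵇ-true (adjacencies≡1⇒numAdj≡2 σ one)) pσ)))

not-≡ᵇ⇒≢ : ∀ {a b} → not (a ≡ᵇ b) ≡ true → a ≢ b
not-≡ᵇ⇒≢ e a≡b = not-¬ (≡⇒≡ᵇ-true a≡b) (not-injective e)

≢⇒not-≡ᵇ : ∀ {a b} → a ≢ b → not (a ≡ᵇ b) ≡ true
≢⇒not-≡ᵇ a≢b = cong not (≢⇒≡ᵇ-false a≢b)

∈-counted-first⁻ : ∀ n {σ} → σ ∈ countedFirst n → FirstNotMax n σ
∈-counted-first⁻ n σ∈ with adm , e ← ∈-counted⁻ n (firstNotN n) σ∈ = adm , not-≡ᵇ⇒≢ e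

∈-counted-first⁺ : ∀ n {σ} → FirstNotMax n σ → σ ∈ countedFirst n
∈-counted-first⁺ n (adm , σ₁≢n) = ∈-counted⁺ n (firstNotN n) adm (≢⇒not-≡ᵇ σ₁≢n)

∈-counted-last⁻ : ∀ n {σ} → σ ∈ countedLast n → LastNotMax n σ
∈-counted-last⁻ n {σ} σ∈ with adm@((refl , _) , _) , e ← ∈-counted⁻ n (lastNotN n) σ∈ =
  adm , subst (_≢ n) (!-length≡lastOr σ) (not-≡ᵇ⇒≢ e)

∈-counted-last⁺ : ∀ n {σ} → LastNotMax n σ → σ ∈ countedLast n
∈-counted-last⁺ n {σ} (adm@((refl , _) , _) , σₙ≢n) =
  ∈-counted⁺ n (lastNotN n) adm (≢⇒not-≡ᵇ (subst (_≢ n) (sym (!-length≡lastOr σ)) σₙ≢n))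

liftMaxOne : ℕ → List ℕ → List ℕ
liftMaxOne N γ = map suc γ ++ N ∷ 1 ∷ []

IntervalPerm-∷ʳ-max : ∀ {n} α → IntervalPerm 1 n α → IntervalPerm 1 (suc n) (α ++ [ suc n ])
IntervalPerm-∷ʳ-max {n} α (len , bounded , u) =
  trans (length-++ α) (trans (cong (_+ 1) len) (+-comm n 1)) ,
  All.++⁺ (All.map (λ (lo≤x , x<) → lo≤x , m≤n⇒m≤1+n x<) bounded) ((s≤s z≤n , ≤-refl) ∷ []) ,
  Unique.++⁺ u ([] ∷ []) λ { (x∈ , here refl) → <-irrefl refl (proj₂ (All.lookup bounded x∈)) }

IntervalPerm-∷-max : ∀ {n} β → IntervalPerm 1 n β → IntervalPerm 1 (suc n) (suc n ∷ β)
IntervalPerm-∷-max β (len , bounded , u) =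
  cong suc len ,
  (s≤s z≤n , ≤-refl) ∷ All.map (λ (lo≤x , x<) → lo≤x , m≤n⇒m≤1+n x<) bounded ,
  All.map (λ (_ , x<) n≡x → <-irrefl (sym n≡x) x<) bounded ∷ u

IntervalPerm-liftMaxOne : ∀ {p} γ → IntervalPerm 1 p γ → IntervalPerm 1 (2 + p) (liftMaxOne (2 + p) γ)
IntervalPerm-liftMaxOne {p} γ (len , bounded , u) =
  trans (length-++ (map suc γ)) (trans (cong (_+ 2) (trans (length-map suc γ) len)) (+-comm p 2)) ,
  All.++⁺ (All.map⁺ (All.map (λ (_ , x<) → s≤s z≤n , s≤s (m≤n⇒m≤1+n x<)) bounded))
          ((s≤s z≤n , ≤-refl) ∷ (≤-refl , s≤s (s≤s z≤n)) ∷ []) ,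
  Unique.++⁺ (Unique.map⁺ suc-injective u) (((λ ()) ∷ []) ∷ [] ∷ []) disjoint
  where
  disjoint : Disjoint (map suc γ) ((2 + p) ∷ 1 ∷ [])
  disjoint (v∈ , v∈top1) with x , x∈ , refl ← ∈-map⁻ suc v∈ | v∈top1
  ... | here refl = <-irrefl refl (proj₂ (All.lookup bounded x∈))
  ... | there (here refl) with () ← proj₁ (All.lookup bounded x∈)

append-max : ∀ p α → LastNotMax (suc p) α → FirstNotMax (2 + p) (α ++ [ 2 + p ])
append-max p [] (((() , _) , _) , _)
append-max p α@(x ∷ α′) ((perm@(_ , bounded , _) , avoids , one) , last≢) =
  (IntervalPerm-∷ʳ-max α perm , trans (has132-++-[max] α N below) avoids , one′) , first≢
  where
  N = 2 + p
  below : All (_< N) α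
  below = All.map proj₂ bounded
  last<N : lastOr x α′ < N
  last<N = All.lookup below (lastOr-∈ x α′)
  one′ : adjacencies (α ++ [ N ]) ≡ 1
  one′ = begin
    adjacenciesFrom x (α′ ++ [ N ])                                  ≡⟨ adjacenciesFrom-++ x α′ [ N ] ⟩
    adjacencies α + (toℕ (absDiff1 (lastOr x α′) N) + 0)              ≡⟨ cong₂ (λ a b → a + (toℕ b + 0)) one
      (absDiff1-false (last≢ ∘ suc-injective) (λ e → <-asym last<N (subst (N <_) e ≤-refl))) ⟩
    1                                                                 ∎
    where open ≡-Reasoning
  first≢ : x ≢ N
  first≢ x≡N = <-irrefl x≡N (All.lookup below (here refl))

prepend-max : ∀ p β → FirstNotMax (suc p) β → LastNotMax (2 + p) ((2 + p) ∷ β)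
prepend-max p [] (((() , _) , _) , _)
prepend-max p β@(y ∷ β′) ((perm@(_ , bounded , _) , avoids , one) , first≢) =
  (IntervalPerm-∷-max β perm , avoids′ , one′) , last≢
  where
  N = 2 + p
  below : All (_< N) β
  below = All.map proj₂ bounded
  avoids′ : has132 (N ∷ β) ≡ false
  avoids′ rewrite opens132-max N β below = avoids
  one′ : adjacencies (N ∷ β) ≡ 1
  one′ = trans (cong (λ b → toℕ b + adjacenciesFrom y β′)
           (absDiff1-false (λ e → <-asym (All.lookup below (here refl)) (subst (N <_) e ≤-refl))
                           (first≢ ∘ suc-injective))) one
  last≢ : lastOr y β′ ≢ N
  last≢ e = <-irrefl e (All.lookup below (lastOr-∈ y β′))

liftMaxOne-admissible : ∀ p γ → 1 ≤ p → LastNotMax p γ → Admissible (2 + p) (liftMaxOne (2 + p) γ)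
liftMaxOne-admissible (suc p) [] _ (((() , _) , _) , _)
liftMaxOne-admissible p γ@(x ∷ γ′) 1≤p ((perm@(_ , bounded , _) , avoids , one) , last≢) =
  IntervalPerm-liftMaxOne γ perm , avoids′ , one′
  where
  N = 2 + p
  lifted<N : All (_< N) (map suc γ)
  lifted<N = All.map⁺ (All.map (λ (_ , x<) → s≤s x<) bounded)
  1<lifted : All (1 <_) (map suc γ ++ [ N ])
  1<lifted = All.++⁺ (All.map⁺ (All.map (λ (1≤x , _) → s≤s 1≤x) bounded)) (s≤s (s≤s z≤n) ∷ [])
  avoids′ : has132 (liftMaxOne N γ) ≡ false
  avoids′ = begin
    has132 (map suc γ ++ N ∷ 1 ∷ [])        ≡⟨ cong has132 (sym (++-assoc (map suc γ) [ N ] [ 1 ])) ⟩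
    has132 ((map suc γ ++ [ N ]) ++ [ 1 ])  ≡⟨ has132-++-[min] _ 1 1<lifted ⟩
    has132 (map suc γ ++ [ N ])             ≡⟨ has132-++-[max] _ N lifted<N ⟩
    has132 (map suc γ)                      ≡⟨ has132-map-suc γ ⟩
    has132 γ                                ≡⟨ avoids ⟩
    false                                   ∎
    where open ≡-Reasoning
  last = lastOr x γ′
  last<1+p : last < suc p
  last<1+p = proj₂ (All.lookup bounded (lastOr-∈ x γ′))
  not-adj-last : absDiff1 (suc last) N ≡ false
  not-adj-last = absDiff1-false (last≢ ∘ suc-injective ∘ suc-injective)
                                (λ e → <⇒≱ last<1+p (≤-trans (n≤1+n (suc p)) (≤-reflexive (suc-injective e))))
  not-adj-one : absDiff1 N 1 ≡ false
  not-adj-one = absDiff1-false (λ ()) (λ e → <⇒≢ 1≤p (sym (suc-injective (suc-injective (sym e)))))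
  one′ : adjacencies (liftMaxOne N γ) ≡ 1
  one′ = begin
    adjacenciesFrom (suc x) (map suc γ′ ++ N ∷ 1 ∷ [])
      ≡⟨ adjacenciesFrom-++ (suc x) (map suc γ′) (N ∷ 1 ∷ []) ⟩
    adjacenciesFrom (suc x) (map suc γ′) + (toℕ (absDiff1 (lastOr (suc x) (map suc γ′)) N) + (toℕ (absDiff1 N 1) + 0))
      ≡⟨ cong₂ _+_ (adjacenciesFrom-map-suc x γ′)
               (cong (λ l → toℕ (absDiff1 l N) + (toℕ (absDiff1 N 1) + 0)) (lastOr-map-suc x γ′)) ⟩
    adjacencies γ + (toℕ (absDiff1 (suc last) N) + (toℕ (absDiff1 N 1) + 0))
      ≡⟨ cong₂ (λ b c → adjacencies γ + (toℕ b + (toℕ c + 0))) not-adj-last not-adj-one ⟩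
    adjacencies γ + 0
      ≡⟨ trans (+-identityʳ _) one ⟩
    1 ∎
    where open ≡-Reasoning

liftMaxOne-first≢ : ∀ p γ → Admissible p γ → liftMaxOne (2 + p) γ ! 1 ≢ 2 + p
liftMaxOne-first≢ p (x ∷ γ) ((_ , x∈ ∷ _ , _) , _) e = <-irrefl (suc-injective e) (proj₂ x∈)
liftMaxOne-first≢ (suc p) [] ((() , _) , _)

liftMaxOne-last≢ : ∀ p γ → lastOr 0 (liftMaxOne (2 + p) γ) ≢ 2 + p
liftMaxOne-last≢ p γ e with () ← trans (sym (lastOr-++-∷ 0 (map suc γ) (2 + p) [ 1 ])) e

+-≡1-split : ∀ a b → a + b ≡ 1 → 1 ≤ a → a ≡ 1 × b ≡ 0
+-≡1-split (suc a) b e _ = cong suc (m+n≡0⇒m≡0 a (suc-injective e)) , m+n≡0⇒n≡0 a (suc-injective e)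

toℕ-absDiff1-below : ∀ {l m} → toℕ (absDiff1 l (suc m)) ≡ 0 → l ≢ m
toℕ-absDiff1-below {m = m} e refl with () ← trans (sym (cong toℕ (absDiff1-n-1+n m))) e

toℕ-absDiff1-above : ∀ {l m} → toℕ (absDiff1 (suc m) l) ≡ 0 → l ≢ m
toℕ-absDiff1-above {m = m} e refl with () ← trans (sym (cong toℕ (absDiff1-1+n-n m))) e

length-++-∷ : ∀ α β (x : ℕ) {n} → length (α ++ x ∷ β) ≡ suc n → length α + length β ≡ n
length-++-∷ α β x e = suc-injective (trans (sym (trans (length-++ α) (+-suc _ _))) e)

resize : ∀ {lo n m σ} → n ≡ m → IntervalPerm lo n σ → IntervalPerm lo m σ
resize refl perm = perm

IntervalPerm-unlift : ∀ {lo n} α → IntervalPerm (suc lo) n α → ∃ λ γ → IntervalPerm lo n γ × α ≡ map suc γ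
IntervalPerm-unlift α (len , bounded , u) = map pred α , perm , sym α≡
  where
  α≡ : map suc (map pred α) ≡ α
  α≡ = trans (sym (map-∘ α)) (map-id-local (All.map (λ { (s≤s _ , _) → refl }) bounded))
  perm = trans (length-map pred α) len ,
         All.map⁺ (All.map (λ { (s≤s lo≤x , s≤s x<) → lo≤x , x< }) bounded) ,
         Unique.map⁻ (subst Unique (sym α≡) u)

ends-with-max : ∀ p α → 1 ≤ p → Admissible (2 + p) (α ++ [ 2 + p ]) → LastNotMax (suc p) α
ends-with-max zero _ () _
ends-with-max (suc p) [] _ ((() , _) , _)
ends-with-max (suc p) α@(x ∷ α′) _ (perm , avoids , one) = (permα , avoidsα , proj₁ split) , last≢
  where
  N = 3 + p
  permα : IntervalPerm 1 (2 + p) α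
  permα = resize (trans (sym (+-identityʳ _)) (length-++-∷ α [] N (proj₁ perm)))
                 (proj₁ (decompose-at-max 1 (2 + p) α [] perm avoids))
  avoidsα = has132-++⁻ˡ α [ N ] avoids
  split = +-≡1-split (adjacencies α) _ (trans (sym (adjacenciesFrom-++ x α′ [ N ])) one)
                     (has-adjacency α permα avoidsα)
  last≢ : lastOr x α′ ≢ 2 + p
  last≢ = toℕ-absDiff1-below (m+n≡0⇒m≡0 _ (proj₂ split))

starts-with-max : ∀ p β → 1 ≤ p → Admissible (2 + p) ((2 + p) ∷ β) → FirstNotMax (suc p) β
starts-with-max zero _ () _
starts-with-max (suc p) [] _ ((() , _) , _)
starts-with-max (suc p) β@(y ∷ β′) _ (perm , avoids , one) = (permβ , avoidsβ , proj₁ split) , y≢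
  where
  N = 3 + p
  permβ : IntervalPerm 1 (2 + p) β
  permβ = resize (suc-injective (proj₁ perm)) (proj₂ (decompose-at-max 1 (2 + p) [] β perm avoids))
  avoidsβ = proj₂ (∨-false⁻ {opens132 N β} avoids)
  split = +-≡1-split (adjacencies β) (toℕ (absDiff1 N y)) (trans (+-comm _ (toℕ (absDiff1 N y))) one)
                     (has-adjacency β permβ avoidsβ)
  y≢ : y ≢ 2 + p
  y≢ = toℕ-absDiff1-above (proj₂ split)

ends-with-max-one : ∀ p α y → 2 ≤ p → Admissible (2 + p) (α ++ (2 + p) ∷ y ∷ []) →
  ∃ λ γ → α ++ (2 + p) ∷ y ∷ [] ≡ liftMaxOne (2 + p) γ × LastNotMax p γ
ends-with-max-one zero _ _ () _
ends-with-max-one (suc zero) _ _ (s≤s ()) _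
ends-with-max-one (suc (suc p)) [] y _ ((() , _) , _)
ends-with-max-one (suc (suc p)) α@(x ∷ α′) y _ (perm , avoids , one)
  with permα , permy ← decompose-at-max 1 (3 + p) α (y ∷ []) perm avoids
  with refl ← singleton-interval permy
  with γ@(g ∷ γ′) , permγ , refl ← IntervalPerm-unlift α
         (resize (suc-injective (trans (+-comm 1 (length α)) (length-++-∷ α [ y ] (4 + p) (proj₁ perm)))) permα)
  = γ , refl , (permγ , avoidsγ , trans (sym (adjacencies-map-suc γ)) (proj₁ split)) , last≢
  where
  N = 4 + p
  avoidsγ : has132 γ ≡ false
  avoidsγ = trans (sym (has132-map-suc γ)) (has132-++⁻ˡ (map suc γ) _ avoids)
  split = +-≡1-split (adjacencies α) _ (trans (sym (adjacenciesFrom-++ x α′ (N ∷ [ 1 ]))) one)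
                     (subst (1 ≤_) (sym (adjacencies-map-suc γ)) (has-adjacency γ permγ avoidsγ))
  last≢ : lastOr g γ′ ≢ 2 + p
  last≢ e = toℕ-absDiff1-below (m+n≡0⇒m≡0 _ (proj₂ split)) (trans (lastOr-map-suc g γ′) (cong suc e))

-- An adjacency among at least two entries after the maximum uses up the only one allowed.
max-before-two-isolated : ∀ p x α′ y z β′ → Admissible (2 + p) ((x ∷ α′) ++ (2 + p) ∷ y ∷ z ∷ β′) →
  adjacencies (x ∷ α′) ≡ 0 × toℕ (absDiff1 (lastOr x α′) (2 + p)) ≡ 0
max-before-two-isolated p x α′ y z β′ (perm , avoids , one) =
  proj₂ outer , proj₂ (+-≡1-split (adjacenciesFrom N β) _ (trans (+-comm (adjacenciesFrom N β) _) (proj₁ outer)) adjβ)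
  where
  N = 2 + p
  β = y ∷ z ∷ β′
  avoidsβ = proj₂ (∨-false⁻ {opens132 N β} (has132-++⁻ʳ (x ∷ α′) (N ∷ β) avoids))
  adjβ : 1 ≤ adjacenciesFrom N β
  adjβ = ≤-trans (has-adjacency β (proj₂ (decompose-at-max 1 (suc p) (x ∷ α′) β perm avoids)) avoidsβ)
                 (adjacencies≤adjacenciesFrom N β)
  outer = +-≡1-split (toℕ (absDiff1 (lastOr x α′) N) + adjacenciesFrom N β) (adjacencies (x ∷ α′))
            (trans (+-comm _ (adjacencies (x ∷ α′))) (trans (sym (adjacenciesFrom-++ x α′ (N ∷ β))) one))
            (≤-trans adjβ (m≤n+m _ (toℕ (absDiff1 (lastOr x α′) N))))

max-not-before-two : ∀ p x α′ y z β′ → ¬ Admissible (2 + p) ((x ∷ α′) ++ (2 + p) ∷ y ∷ z ∷ β′)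
max-not-before-two p x [] y z β′ adm@(perm , avoids , _)
  with refl ← singleton-interval (proj₁ (decompose-at-max 1 (suc p) [ x ] (y ∷ z ∷ β′) perm avoids))
  = toℕ-absDiff1-below (proj₂ (max-before-two-isolated p x [] y z β′ adm))
      (cong suc (length-++-∷ [ x ] (y ∷ z ∷ β′) (2 + p) (proj₁ perm)))
max-not-before-two p x α′@(_ ∷ _) y z β′ adm@(perm , avoids , _) =
  1+n≰n (subst (1 ≤_) (proj₁ (max-before-two-isolated p x α′ y z β′ adm))
    (has-adjacency (x ∷ α′) (proj₁ (decompose-at-max 1 (suc p) (x ∷ α′) (y ∷ z ∷ β′) perm avoids))
                   (has132-++⁻ˡ (x ∷ α′) _ avoids)))

data Shape (p : ℕ) : List ℕ → Set where
  _∷ʳmax : ∀ {α} → LastNotMax (suc p) α → Shape p (α ++ [ 2 + p ])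
  max∷_ : ∀ {β} → FirstNotMax (suc p) β → Shape p ((2 + p) ∷ β)
  liftMaxOne⟨_⟩ : ∀ {γ} → LastNotMax p γ → Shape p (liftMaxOne (2 + p) γ)

shape-around-max : ∀ p → 2 ≤ p → ∀ α β →
  Admissible (2 + p) (α ++ (2 + p) ∷ β) → Shape p (α ++ (2 + p) ∷ β)
shape-around-max p _ [] [] ((() , _) , _)
shape-around-max p 2≤p [] (y ∷ β′) adm = max∷ starts-with-max p (y ∷ β′) (≤-trans (s≤s z≤n) 2≤p) adm
shape-around-max p 2≤p α@(_ ∷ _) [] adm = ends-with-max p α (≤-trans (s≤s z≤n) 2≤p) adm ∷ʳmax
shape-around-max p 2≤p α@(_ ∷ _) (y ∷ []) adm with γ , eq , lnm ← ends-with-max-one p α y 2≤p adm =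
  subst (Shape p) (sym eq) liftMaxOne⟨ lnm ⟩
shape-around-max p _ (x ∷ α′) (y ∷ z ∷ β′) adm = ⊥-elim (max-not-before-two p x α′ y z β′ adm)

shape : ∀ p → 2 ≤ p → ∀ σ → Admissible (2 + p) σ → Shape p σ
shape p 2≤p σ adm with α , β , refl ← ∈-∃++ (max∈ 1 (suc p) σ (proj₁ adm)) = shape-around-max p 2≤p α β adm

-- Counting

length-partition : ∀ {B : Set} {xs : List A} {ys zs : List B} (f g : B → A) →
  Unique xs → Unique ys → Unique zs →
  (∀ {a b} → f a ≡ f b → a ≡ b) → (∀ {a b} → g a ≡ g b → a ≡ b) →
  (∀ {y z} → y ∈ ys → z ∈ zs → f y ≢ g z) →
  (∀ {σ} → σ ∈ xs → (∃ λ y → y ∈ ys × σ ≡ f y) ⊎ (∃ λ z → z ∈ zs × σ ≡ g z)) →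
  (∀ {y} → y ∈ ys → f y ∈ xs) → (∀ {z} → z ∈ zs → g z ∈ xs) →
  length xs ≡ length ys + length zs
length-partition {xs = xs} {ys} {zs} f g uxs uys uzs f-inj g-inj apart split f∈ g∈ = begin
  length xs                             ≡⟨ ↭-length (∼bag⇒↭ (unique∧set⇒bag uxs uimages (mk⇔ to from))) ⟩
  length (map f ys ++ map g zs)         ≡⟨ length-++ (map f ys) ⟩
  length (map f ys) + length (map g zs) ≡⟨ cong₂ _+_ (length-map f ys) (length-map g zs) ⟩
  length ys + length zs                 ∎
  where
  open ≡-Reasoning
  uimages : Unique (map f ys ++ map g zs)
  uimages = Unique.++⁺ (Unique.map⁺ f-inj uys) (Unique.map⁺ g-inj uzs) disjoint
    where
    disjoint : Disjoint (map f ys) (map g zs)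
    disjoint (fy∈ , gz∈) with y , y∈ , refl ← ∈-map⁻ f fy∈ | z , z∈ , eq ← ∈-map⁻ g gz∈ =
      apart y∈ z∈ eq
  to : ∀ {σ} → σ ∈ xs → σ ∈ map f ys ++ map g zs
  to σ∈ with split σ∈
  ... | inj₁ (y , y∈ , refl) = ∈-++⁺ˡ (∈-map⁺ f y∈)
  ... | inj₂ (z , z∈ , refl) = ∈-++⁺ʳ (map f ys) (∈-map⁺ g z∈)
  from : ∀ {σ} → σ ∈ map f ys ++ map g zs → σ ∈ xs
  from σ∈ with ∈-++⁻ (map f ys) σ∈
  ... | inj₁ fy∈ with y , y∈ , refl ← ∈-map⁻ f fy∈ = f∈ y∈
  ... | inj₂ gz∈ with z , z∈ , refl ← ∈-map⁻ g gz∈ = g∈ z∈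

liftMaxOne-injective : ∀ N {a b} → liftMaxOne N a ≡ liftMaxOne N b → a ≡ b
liftMaxOne-injective N {a} {b} e = map-injective suc-injective (++-cancelʳ (N ∷ [ 1 ]) (map suc a) (map suc b) e)

countedFirst-recurrence : ∀ p → 2 ≤ p →
  length (countedFirst (2 + p)) ≡ length (countedLast (suc p)) + length (countedLast p)
countedFirst-recurrence p 2≤p =
  length-partition (_++ [ N ]) (liftMaxOne N) (counted-unique N _) (counted-unique (suc p) _) (counted-unique p _)
    (λ {a} {b} → ++-cancelʳ [ N ] a b) (liftMaxOne-injective N) apart split
    (λ α∈ → ∈-counted-first⁺ N (append-max p _ (∈-counted-last⁻ (suc p) α∈)))
    (λ {γ} γ∈ → let lnm@(adm , _) = ∈-counted-last⁻ p γ∈ in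
      ∈-counted-first⁺ N (liftMaxOne-admissible p γ (≤-trans (s≤s z≤n) 2≤p) lnm , liftMaxOne-first≢ p γ adm))
  where
  N = 2 + p
  apart : ∀ {α γ} → α ∈ countedLast (suc p) → γ ∈ countedLast p → α ++ [ N ] ≢ liftMaxOne N γ
  apart {α} {γ} _ _ e
    with () ← trans (sym (lastOr-++-∷ 0 α N [])) (trans (cong (lastOr 0) e) (lastOr-++-∷ 0 (map suc γ) N [ 1 ]))
  split : ∀ {σ} → σ ∈ countedFirst N →
    (∃ λ α → α ∈ countedLast (suc p) × σ ≡ α ++ [ N ]) ⊎ (∃ λ γ → γ ∈ countedLast p × σ ≡ liftMaxOne N γ)
  split {σ} σ∈ with adm , first≢ ← ∈-counted-first⁻ N σ∈ | shape p 2≤p σ adm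
  ... | lnm ∷ʳmax = inj₁ (_ , ∈-counted-last⁺ (suc p) lnm , refl)
  ... | max∷ _ = ⊥-elim (first≢ refl)
  ... | liftMaxOne⟨ lnm ⟩ = inj₂ (_ , ∈-counted-last⁺ p lnm , refl)

countedLast-recurrence : ∀ p → 2 ≤ p →
  length (countedLast (2 + p)) ≡ length (countedFirst (suc p)) + length (countedLast p)
countedLast-recurrence p 2≤p =
  length-partition (N ∷_) (liftMaxOne N) (counted-unique N _) (counted-unique (suc p) _) (counted-unique p _)
    (proj₂ ∘ ∷-injective) (liftMaxOne-injective N) apart split
    (λ β∈ → ∈-counted-last⁺ N (prepend-max p _ (∈-counted-first⁻ (suc p) β∈)))
    (λ {γ} γ∈ → ∈-counted-last⁺ N
      (liftMaxOne-admissible p γ (≤-trans (s≤s z≤n) 2≤p) (∈-counted-last⁻ p γ∈) , liftMaxOne-last≢ p γ))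
  where
  N = 2 + p
  apart : ∀ {β γ} → β ∈ countedFirst (suc p) → γ ∈ countedLast p → N ∷ β ≢ liftMaxOne N γ
  apart {β} {g ∷ γ} _ γ∈ e with ((_ , g∈ ∷ _ , _) , _) , _ ← ∈-counted-last⁻ p γ∈ =
    <-irrefl (sym (suc-injective (proj₁ (∷-injective e)))) (proj₂ g∈)
  apart {β} {[]} _ γ∈ _ with ((len , _) , _) , _ ← ∈-counted-last⁻ p γ∈ =
    <⇒≢ (≤-trans (s≤s z≤n) 2≤p) len
  split : ∀ {σ} → σ ∈ countedLast N →
    (∃ λ β → β ∈ countedFirst (suc p) × σ ≡ N ∷ β) ⊎ (∃ λ γ → γ ∈ countedLast p × σ ≡ liftMaxOne N γ)
  split {σ} σ∈ with adm , last≢ ← ∈-counted-last⁻ N σ∈ | shape p 2≤p σ adm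
  ... | _∷ʳmax {α} _ = ⊥-elim (last≢ (lastOr-++-∷ 0 α N []))
  ... | max∷ fnm = inj₁ (_ , ∈-counted-first⁺ (suc p) fnm , refl)
  ... | liftMaxOne⟨ lnm ⟩ = inj₂ (_ , ∈-counted-last⁺ p lnm , refl)

counts : ∀ p → length (countedFirst (2 + p)) ≡ fib (suc p) × length (countedLast (2 + p)) ≡ fib (suc p)
counts zero = refl , refl
counts (suc zero) = refl , refl
counts (suc (suc p)) =
  trans (countedFirst-recurrence (2 + p) (s≤s (s≤s z≤n))) (cong₂ _+_ (proj₂ (counts (suc p))) (proj₂ (counts p))) ,
  trans (countedLast-recurrence (2 + p) (s≤s (s≤s z≤n))) (cong₂ _+_ (proj₁ (counts (suc p))) (proj₂ (counts p)))

corollary1 : (n : ℕ) → 2 ≤ n →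
    (count n (firstNotN n) ≡ fib (n ∸ 1)) × (count n (lastNotN n) ≡ fib (n ∸ 1))
corollary1 (suc (suc p)) (s≤s (s≤s z≤n)) = counts p
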